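{- Let $\Phi$ be a three-array scheme with query function $(x,y,z)\mapsto(x\wedge y)\oplus z$, for sets of size at most $n\ge1$ from $[m]$. Then the family $\{P_S: S\subseteq[m],\ |S|=n\}$ consists of $\binom mn$ distinct polynomials and is linearly independent in the vector space $V$.
   Context: A three-array scheme: memory consists of three bit arrays $A[1..s],B[1..s],C[1..s]$, each location viewed as a Boolean variable; each $u\in[m]$ has probe locations $x(u)\in A$, $y(u)\in B$, $z(u)\in C$; for every $S\subseteq[m]$ with $|S|\le n$ there is an assignment $\sigma(S)\in\{0,1\}^{3s}$ such that for all $u\in[m]$, $(x(u)\wedge y(u))\oplus z(u)=1$ iff $u\in S$. Over $\mathbb F_2$ this query function is $xy+z$. $V$ is the $\mathbb F_2$-vector space of multilinear polynomials of total degree at most $2n$ in the $3s$ variables $A[1..s],B[1..s],C[1..s]$. For $S\subseteq[m]$, $P_S=\prod_{u\in S}(x(u)y(u)+z(u))$ over $\mathbb F_2$, made multilinear by the reduction $v^2=v$ for every variable $v$. -}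

module Defs where

open import Data.Nat using (ℕ; _+_; _*_; _≤_)
open import Data.Bool using (Bool; true; false; not; _∧_; _xor_; if_then_else_)
open import Data.Bool.Properties using () renaming (_≟_ to _≟ᵇ_)
open import Data.Fin using (Fin)
open import Data.Fin.Subset using (Subset; _∈_; ⁅_⁆; ⊥; _∪_; ∣_∣)
open import Data.Vec using (lookup)
import Data.Vec.Properties as VP
import Data.Product.Properties as PP
open import Data.Product using (_×_; _,_)
open import Data.List using (List; []; _∷_; foldr; map; concatMap; allFin)
open import Relation.Binary.PropositionalEquality using (_≡_)
open import Relation.Binary.Definitions using (DecidableEquality)
open import Relation.Nullary using (does)

-- A three-array scheme for sets of size at most n from [m], arrays of size s,
-- with query function (x ∧ y) ⊕ z.  Memory locations A[i], B[i], C[i] (i : Fin s).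
record ThreeArrayScheme (m n s : ℕ) : Set where
  field
    x y z : Fin m → Fin s
    σA σB σC : (S : Subset m) → ∣ S ∣ ≤ n → Fin s → Bool
    correct : (S : Subset m) (h : ∣ S ∣ ≤ n) (u : Fin m) →
      (((σA S h (x u) ∧ σB S h (y u)) xor σC S h (z u)) ≡ true → u ∈ S)
      × (u ∈ S → ((σA S h (x u) ∧ σB S h (y u)) xor σC S h (z u)) ≡ true)

-- Multilinear monomials in the 3s variables A[1..s], B[1..s], C[1..s]:
-- a set of A-variables, a set of B-variables and a set of C-variables.
Mono : ℕ → Set
Mono s = Subset s × Subset s × Subset s

_≟ₘ_ : ∀ {s} → DecidableEquality (Mono s)
_≟ₘ_ = PP.≡-dec (VP.≡-dec _≟ᵇ_) (PP.≡-dec (VP.≡-dec _≟ᵇ_) (VP.≡-dec _≟ᵇ_))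

deg : ∀ {s} → Mono s → ℕ
deg (a , b , c) = ∣ a ∣ + ∣ b ∣ + ∣ c ∣

-- product of monomials with v² = v (union of variable sets)
_·ₘ_ : ∀ {s} → Mono s → Mono s → Mono s
(a , b , c) ·ₘ (a' , b' , c') = (a ∪ a') , (b ∪ b') , (c ∪ c')

-- Multilinear polynomials over 𝔽₂, as formal sums (lists) of monomials.
-- The coefficient of a monomial is the parity of its number of occurrences.
Poly : ℕ → Set
Poly s = List (Mono s)

coeff : ∀ {s} → Poly s → Mono s → Bool
coeff p M = foldr (λ M' b → if does (M' ≟ₘ M) then not b else b) false p

_≈ₚ_ : ∀ {s} → Poly s → Poly s → Set
p ≈ₚ q = ∀ M → coeff p M ≡ coeff q M

IsZero : ∀ {s} → Poly s → Set
IsZero p = ∀ M → coeff p M ≡ false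

-- membership in V: total degree ≤ d
DegreeAtMost : ∀ {s} → ℕ → Poly s → Set
DegreeAtMost d p = ∀ M → coeff p M ≡ true → deg M ≤ d

oneₚ : ∀ {s} → Poly s
oneₚ = (⊥ , ⊥ , ⊥) ∷ []

_+ₚ_ : ∀ {s} → Poly s → Poly s → Poly s
p +ₚ q = Data.List._++_ p q

_*ₚ_ : ∀ {s} → Poly s → Poly s → Poly s
p *ₚ q = concatMap (λ M → map (M ·ₘ_) q) p

sumₚ : ∀ {s} → List (Poly s) → Poly s
sumₚ = foldr _+ₚ_ []

factor : ∀ {m n s} → ThreeArrayScheme m n s → Fin m → Poly s
factor Φ u = (⁅ x u ⁆ , ⁅ y u ⁆ , ⊥) ∷ (⊥ , ⊥ , ⁅ z u ⁆) ∷ []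
  where open ThreeArrayScheme Φ

P : ∀ {m n s} → ThreeArrayScheme m n s → Subset m → Poly s
P {m} Φ S = foldr (λ u acc → if lookup S u then factor Φ u *ₚ acc else acc) oneₚ (allFin m)

-- Evaluate the polynomials at the memory contents σ(T) of a set T with |T| = n.
-- Since the query at u returns [u ∈ T], the value of P_S there is ∏_{u∈S} [u ∈ T] = [S ⊆ T],
-- which for |S| = |T| is [S = T].  So a linear combination Σ_{S∈L} P_S of distinct such
-- polynomials takes the value 1 at σ(S) for any S in L, and hence is not the zero polynomial;
-- distinctness is the case of two-element combinations.  The degree bound holds because each
-- factor x(u)y(u) + z(u) has degree at most 2.
module Submission where

open import Defs
open import Data.Nat using (ℕ; _≤_; _*_)
open import Data.Fin.Subset using (Subset; ∣_∣)
open import Data.List using (List; []; map)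
open import Data.List.Relation.Unary.All using (All)
open import Data.List.Relation.Unary.Unique.Propositional using (Unique)
open import Data.Product using (_×_)
open import Relation.Binary.PropositionalEquality using (_≡_)

open import Algebra.Bundles using (CommutativeRing)
import Algebra.Properties.CommutativeSemigroup as CommSemigroupProperties
open import Data.Bool using (Bool; true; false; _∧_; _xor_; if_then_else_) renaming (_≟_ to _≟ᵇ_)
open import Data.Bool.Properties
  using ( ∧-assoc; ∧-identityʳ; ∧-zeroʳ; ∧-distribˡ-xor; ∧-distribʳ-xor
        ; xor-assoc; xor-identityʳ; xor-same; ¬-not; xor-∧-commutativeRing )
open import Data.Fin using (Fin; zero; suc)
open import Data.Fin.Subset using (_∈_; _⊆_; ⊥; ⁅_⁆; _∪_; inside; outside)
open import Data.Fin.Subset.Properties using (drop-∷-⊆; p⊆q⇒∣p∣≤∣q∣; ∉⊥; ∣⁅x⁆∣≡1; ∣⊥∣≡0)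
open import Data.List using (_∷_; _++_; foldr; allFin; tabulate; deduplicate)
open import Data.List.Properties using (foldr-map; map-tabulate; ++-identityʳ)
open import Data.List.Membership.Propositional using () renaming (_∈_ to _∈ₗ_; _∉_ to _∉ₗ_)
open import Data.List.Membership.Propositional.Properties using (∈-deduplicate⁺)
open import Data.List.Relation.Unary.All using ([]; _∷_)
import Data.List.Relation.Unary.All as All
open import Data.List.Relation.Unary.All.Properties using (++⁺; map⁺; All¬⇒¬Any)
open import Data.List.Relation.Unary.AllPairs using ([]; _∷_)
open import Data.List.Relation.Unary.Any using (here; there)
import Data.List.Relation.Unary.Unique.DecPropositional.Properties as UniqueDec
open import Data.Nat using (suc; _+_; s≤s; z≤n)
open import Data.Nat.Properties
  using ( ≤-trans; ≤-reflexive; +-mono-≤; +-monoʳ-≤; n≤1+n; +-suc; *-suc; *-zeroʳ; <⇒≢; suc-injective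
        ; +-commutativeSemigroup; module ≤-Reasoning )
open import Data.Product using (_,_; proj₁; proj₂)
open import Data.Vec using ([]; _∷_; here; there; lookup)
open import Data.Vec.Properties using (≡-dec)
open import Function using (_∘_; id)
open import Relation.Nullary using (does; yes; no; contradiction)
open import Relation.Nullary.Decidable using (dec-true; dec-false)
open import Relation.Binary.PropositionalEquality using (refl; sym; trans; cong; cong₂; module ≡-Reasoning)

open CommutativeRing xor-∧-commutativeRing
  using () renaming (+-commutativeSemigroup to xor-commutativeSemigroup; *-commutativeSemigroup to ∧-commutativeSemigroup)

private
  variable
    k m s : ℕ

∣p∪q∣≤∣p∣+∣q∣ : ∀ (p q : Subset k) → ∣ p ∪ q ∣ ≤ ∣ p ∣ + ∣ q ∣
∣p∪q∣≤∣p∣+∣q∣ []            []            = z≤n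
∣p∪q∣≤∣p∣+∣q∣ (outside ∷ p) (outside ∷ q) = ∣p∪q∣≤∣p∣+∣q∣ p q
∣p∪q∣≤∣p∣+∣q∣ (outside ∷ p) (inside ∷ q)  rewrite +-suc ∣ p ∣ ∣ q ∣ = s≤s (∣p∪q∣≤∣p∣+∣q∣ p q)
∣p∪q∣≤∣p∣+∣q∣ (inside ∷ p)  (outside ∷ q) = s≤s (∣p∪q∣≤∣p∣+∣q∣ p q)
∣p∪q∣≤∣p∣+∣q∣ (inside ∷ p)  (inside ∷ q)  = s≤s (≤-trans (∣p∪q∣≤∣p∣+∣q∣ p q) (+-monoʳ-≤ ∣ p ∣ (n≤1+n _)))

p⊆q⇒∣p∣≡∣q∣⇒p≡q : ∀ {p q : Subset k} → p ⊆ q → ∣ p ∣ ≡ ∣ q ∣ → p ≡ q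
p⊆q⇒∣p∣≡∣q∣⇒p≡q {p = []}          {[]}          _   _ = refl
p⊆q⇒∣p∣≡∣q∣⇒p≡q {p = outside ∷ p} {outside ∷ q} p⊆q e =
  cong (outside ∷_) (p⊆q⇒∣p∣≡∣q∣⇒p≡q (drop-∷-⊆ p⊆q) e)
p⊆q⇒∣p∣≡∣q∣⇒p≡q {p = outside ∷ p} {inside ∷ q}  p⊆q e =
  contradiction e (<⇒≢ (s≤s (p⊆q⇒∣p∣≤∣q∣ (drop-∷-⊆ p⊆q))))
p⊆q⇒∣p∣≡∣q∣⇒p≡q {p = inside ∷ p}  {outside ∷ q} p⊆q _ = contradiction (p⊆q here) λ ()
p⊆q⇒∣p∣≡∣q∣⇒p≡q {p = inside ∷ p}  {inside ∷ q}  p⊆q e =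
  cong (inside ∷_) (p⊆q⇒∣p∣≡∣q∣⇒p≡q (drop-∷-⊆ p⊆q) (suc-injective e))

⋀ : Subset k → (Fin k → Bool) → Bool
⋀ []            g = true
⋀ (inside ∷ a)  g = g zero ∧ ⋀ a (g ∘ suc)
⋀ (outside ∷ a) g = ⋀ a (g ∘ suc)

∧≡true⁻ : ∀ x {y} → x ∧ y ≡ true → x ≡ true × y ≡ true
∧≡true⁻ true y≡true = refl , y≡true

⋀-intro : ∀ (a : Subset k) {g} → (∀ {i} → i ∈ a → g i ≡ true) → ⋀ a g ≡ true
⋀-intro []            all = refl
⋀-intro (inside ∷ a)  all = cong₂ _∧_ (all here) (⋀-intro a (all ∘ there))
⋀-intro (outside ∷ a) all = ⋀-intro a (all ∘ there)

⋀-elim : ∀ (a : Subset k) {g i} → ⋀ a g ≡ true → i ∈ a → g i ≡ true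
⋀-elim (inside ∷ a)  {g} ⋀≡true here        = proj₁ (∧≡true⁻ (g zero) ⋀≡true)
⋀-elim (inside ∷ a)  {g} ⋀≡true (there i∈a) = ⋀-elim a (proj₂ (∧≡true⁻ (g zero) ⋀≡true)) i∈a
⋀-elim (outside ∷ a)     ⋀≡true (there i∈a) = ⋀-elim a ⋀≡true i∈a

⋀-∪ : ∀ (a b : Subset k) g → ⋀ (a ∪ b) g ≡ ⋀ a g ∧ ⋀ b g
⋀-∪ []            []            g = refl
⋀-∪ (outside ∷ a) (outside ∷ b) g = ⋀-∪ a b (g ∘ suc)
⋀-∪ (inside ∷ a)  (outside ∷ b) g rewrite ⋀-∪ a b (g ∘ suc) = sym (∧-assoc (g zero) _ _)
⋀-∪ (outside ∷ a) (inside ∷ b)  g rewrite ⋀-∪ a b (g ∘ suc) with g zero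
... | true  = refl
... | false = sym (∧-zeroʳ _)
⋀-∪ (inside ∷ a)  (inside ∷ b)  g rewrite ⋀-∪ a b (g ∘ suc) with g zero
... | true  = refl
... | false = refl

⋀-⊥ : ∀ g → ⋀ (⊥ {k}) g ≡ true
⋀-⊥ {k} g = ⋀-intro (⊥ {k}) (λ i∈⊥ → contradiction i∈⊥ ∉⊥)

⋀-⁅⁆ : ∀ (i : Fin k) g → ⋀ ⁅ i ⁆ g ≡ g i
⋀-⁅⁆ zero    g = trans (cong (g zero ∧_) (⋀-⊥ (g ∘ suc))) (∧-identityʳ (g zero))
⋀-⁅⁆ (suc i) g = ⋀-⁅⁆ i (g ∘ suc)

-- The 𝔽₂-linear extension of f; it is evaluation at a point when f is multiplicative.
eval : (Mono s → Bool) → Poly s → Bool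
eval f = foldr (λ M r → f M xor r) false

eval-++ : ∀ f (p q : Poly s) → eval f (p ++ q) ≡ eval f p xor eval f q
eval-++ f []      q = refl
eval-++ f (M ∷ p) q = trans (cong (f M xor_) (eval-++ f p q)) (sym (xor-assoc (f M) _ _))

eval-cong : ∀ {f g : Mono s → Bool} → (∀ M → f M ≡ g M) → ∀ p → eval f p ≡ eval g p
eval-cong f≗g []      = refl
eval-cong f≗g (M ∷ p) = cong₂ _xor_ (f≗g M) (eval-cong f≗g p)

eval-xor : ∀ (f g : Mono s → Bool) p → eval (λ M → f M xor g M) p ≡ eval f p xor eval g p
eval-xor f g []      = refl
eval-xor f g (M ∷ p) = begin
  (f M xor g M) xor eval (λ M → f M xor g M) p ≡⟨ cong ((f M xor g M) xor_) (eval-xor f g p) ⟩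
  (f M xor g M) xor (eval f p xor eval g p)    ≡⟨ interchange (f M) (g M) (eval f p) (eval g p) ⟩
  (f M xor eval f p) xor (g M xor eval g p)    ∎
  where open ≡-Reasoning
        open CommSemigroupProperties xor-commutativeSemigroup using (interchange)

eval-false : ∀ (p : Poly s) → eval (λ _ → false) p ≡ false
eval-false []      = refl
eval-false (M ∷ p) = eval-false p

coeff-∷ : ∀ (N : Mono s) p M → coeff (N ∷ p) M ≡ does (N ≟ₘ M) xor coeff p M
coeff-∷ N p M with does (N ≟ₘ M)
... | true  = refl
... | false = refl

coeff-++ : ∀ (p q : Poly s) M → coeff (p ++ q) M ≡ coeff p M xor coeff q M
coeff-++ []      q M = refl
coeff-++ (N ∷ p) q M = begin
  coeff (N ∷ p ++ q) M                       ≡⟨ coeff-∷ N (p ++ q) M ⟩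
  does (N ≟ₘ M) xor coeff (p ++ q) M         ≡⟨ cong (does (N ≟ₘ M) xor_) (coeff-++ p q M) ⟩
  does (N ≟ₘ M) xor (coeff p M xor coeff q M) ≡⟨ sym (xor-assoc (does (N ≟ₘ M)) _ _) ⟩
  (does (N ≟ₘ M) xor coeff p M) xor coeff q M ≡⟨ cong (_xor coeff q M) (sym (coeff-∷ N p M)) ⟩
  coeff (N ∷ p) M xor coeff q M              ∎
  where open ≡-Reasoning

eval-δ-∉ : ∀ (f : Mono s → Bool) {M} {D} → M ∉ₗ D → eval (λ N → f N ∧ does (M ≟ₘ N)) D ≡ false
eval-δ-∉ f     {D = []}    M∉D = refl
eval-δ-∉ f {M} {D = N ∷ D} M∉D = cong₂ _xor_
  (trans (cong (f N ∧_) (dec-false (M ≟ₘ N) (M∉D ∘ here))) (∧-zeroʳ (f N)))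
  (eval-δ-∉ f (M∉D ∘ there))

eval-δ-∈ : ∀ (f : Mono s → Bool) {M} {D} → Unique D → M ∈ₗ D → eval (λ N → f N ∧ does (M ≟ₘ N)) D ≡ f M
eval-δ-∈ f {M} (M∉D ∷ _) (here refl) = trans
  (cong₂ _xor_ (trans (cong (f M ∧_) (dec-true (M ≟ₘ M) refl)) (∧-identityʳ (f M)))
               (eval-δ-∉ f (All¬⇒¬Any M∉D)))
  (xor-identityʳ (f M))
eval-δ-∈ f {M} {N ∷ D} (N∉D ∷ D!) (there M∈D) = cong₂ _xor_
  (trans (cong (f N ∧_) (dec-false (M ≟ₘ N) (All.lookup N∉D M∈D ∘ sym))) (∧-zeroʳ (f N)))
  (eval-δ-∈ f D! M∈D)

eval-coeff : ∀ f (p : Poly s) {D} → Unique D → (∀ {M} → M ∈ₗ p → M ∈ₗ D) →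
             eval f p ≡ eval (λ N → f N ∧ coeff p N) D
eval-coeff f []      {D} _  _    = sym (trans (eval-cong (λ N → ∧-zeroʳ (f N)) D) (eval-false D))
eval-coeff f (M ∷ p) {D} D! p⊆D = begin
  f M xor eval f p
    ≡⟨ cong₂ _xor_ (sym (eval-δ-∈ f D! (p⊆D (here refl)))) (eval-coeff f p D! (p⊆D ∘ there)) ⟩
  eval (λ N → f N ∧ does (M ≟ₘ N)) D xor eval (λ N → f N ∧ coeff p N) D
    ≡⟨ sym (eval-xor (λ N → f N ∧ does (M ≟ₘ N)) (λ N → f N ∧ coeff p N) D) ⟩
  eval (λ N → (f N ∧ does (M ≟ₘ N)) xor (f N ∧ coeff p N)) D
    ≡⟨ eval-cong (λ N → sym (trans (cong (f N ∧_) (coeff-∷ M p N)) (∧-distribˡ-xor (f N) _ _))) D ⟩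
  eval (λ N → f N ∧ coeff (M ∷ p) N) D
    ∎
  where open ≡-Reasoning

eval-zero : ∀ f (p : Poly s) → IsZero p → eval f p ≡ false
eval-zero f p p≈0 = begin
  eval f p                        ≡⟨ eval-coeff f p (UniqueDec.deduplicate-! _≟ₘ_ p) (∈-deduplicate⁺ _≟ₘ_) ⟩
  eval (λ N → f N ∧ coeff p N) D  ≡⟨ eval-cong (λ N → trans (cong (f N ∧_) (p≈0 N)) (∧-zeroʳ (f N))) D ⟩
  eval (λ _ → false) D            ≡⟨ eval-false D ⟩
  false                           ∎
  where open ≡-Reasoning
        D = deduplicate _≟ₘ_ p

eval-sumₚ : ∀ f (ps : List (Poly s)) → All (λ p → eval f p ≡ false) ps → eval f (sumₚ ps) ≡ false
eval-sumₚ f []       []           = refl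
eval-sumₚ f (p ∷ ps) (p↦0 ∷ ps↦0) = trans (eval-++ f p (sumₚ ps)) (cong₂ _xor_ p↦0 (eval-sumₚ f ps ps↦0))

Multiplicative : (Mono s → Bool) → Set
Multiplicative f = ∀ M N → f (M ·ₘ N) ≡ f M ∧ f N

eval-*ₚ : ∀ (f : Mono s → Bool) → Multiplicative f → ∀ p q → eval f (p *ₚ q) ≡ eval f p ∧ eval f q
eval-*ₚ f f-mul []      q = refl
eval-*ₚ f f-mul (M ∷ p) q = begin
  eval f (map (M ·ₘ_) q ++ p *ₚ q)           ≡⟨ eval-++ f (map (M ·ₘ_) q) (p *ₚ q) ⟩
  eval f (map (M ·ₘ_) q) xor eval f (p *ₚ q) ≡⟨ cong₂ _xor_ (eval-map-·ₘ q) (eval-*ₚ f f-mul p q) ⟩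
  (f M ∧ eval f q) xor (eval f p ∧ eval f q) ≡⟨ sym (∧-distribʳ-xor (eval f q) (f M) (eval f p)) ⟩
  (f M xor eval f p) ∧ eval f q              ∎
  where
  open ≡-Reasoning
  eval-map-·ₘ : ∀ q → eval f (map (M ·ₘ_) q) ≡ f M ∧ eval f q
  eval-map-·ₘ []      = sym (∧-zeroʳ (f M))
  eval-map-·ₘ (N ∷ q) = trans (cong₂ _xor_ (f-mul M N) (eval-map-·ₘ q)) (sym (∧-distribˡ-xor (f M) (f N) _))

evalAt : (gA gB gC : Fin s → Bool) → Mono s → Bool
evalAt gA gB gC (a , b , c) = ⋀ a gA ∧ ⋀ b gB ∧ ⋀ c gC

evalAt-multiplicative : ∀ (gA gB gC : Fin s → Bool) → Multiplicative (evalAt gA gB gC)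
evalAt-multiplicative gA gB gC (a , b , c) (a′ , b′ , c′) = begin
  ⋀ (a ∪ a′) gA ∧ ⋀ (b ∪ b′) gB ∧ ⋀ (c ∪ c′) gC
    ≡⟨ cong₂ _∧_ (⋀-∪ a a′ gA) (cong₂ _∧_ (⋀-∪ b b′ gB) (⋀-∪ c c′ gC)) ⟩
  (⋀ a gA ∧ ⋀ a′ gA) ∧ (⋀ b gB ∧ ⋀ b′ gB) ∧ (⋀ c gC ∧ ⋀ c′ gC)
    ≡⟨ cong ((⋀ a gA ∧ ⋀ a′ gA) ∧_) (interchange (⋀ b gB) _ _ _) ⟩
  (⋀ a gA ∧ ⋀ a′ gA) ∧ (⋀ b gB ∧ ⋀ c gC) ∧ (⋀ b′ gB ∧ ⋀ c′ gC)
    ≡⟨ interchange (⋀ a gA) _ _ _ ⟩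
  (⋀ a gA ∧ ⋀ b gB ∧ ⋀ c gC) ∧ (⋀ a′ gA ∧ ⋀ b′ gB ∧ ⋀ c′ gC)
    ∎
  where open ≡-Reasoning
        open CommSemigroupProperties ∧-commutativeSemigroup using (interchange)

evalAt-oneₚ : ∀ (gA gB gC : Fin s → Bool) → eval (evalAt gA gB gC) oneₚ ≡ true
evalAt-oneₚ gA gB gC rewrite ⋀-⊥ gA | ⋀-⊥ gB | ⋀-⊥ gC = refl

deg-·ₘ : ∀ (M N : Mono s) → deg (M ·ₘ N) ≤ deg M + deg N
deg-·ₘ (a , b , c) (a′ , b′ , c′) = begin
  ∣ a ∪ a′ ∣ + ∣ b ∪ b′ ∣ + ∣ c ∪ c′ ∣
    ≤⟨ +-mono-≤ (+-mono-≤ (∣p∪q∣≤∣p∣+∣q∣ a a′) (∣p∪q∣≤∣p∣+∣q∣ b b′)) (∣p∪q∣≤∣p∣+∣q∣ c c′) ⟩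
  (∣ a ∣ + ∣ a′ ∣) + (∣ b ∣ + ∣ b′ ∣) + (∣ c ∣ + ∣ c′ ∣)
    ≡⟨ cong (_+ (∣ c ∣ + ∣ c′ ∣)) (interchange (∣ a ∣) (∣ a′ ∣) (∣ b ∣) (∣ b′ ∣)) ⟩
  (∣ a ∣ + ∣ b ∣) + (∣ a′ ∣ + ∣ b′ ∣) + (∣ c ∣ + ∣ c′ ∣)
    ≡⟨ interchange (∣ a ∣ + ∣ b ∣) _ _ _ ⟩
  (∣ a ∣ + ∣ b ∣ + ∣ c ∣) + (∣ a′ ∣ + ∣ b′ ∣ + ∣ c′ ∣)
    ∎
  where open ≤-Reasoning
        open CommSemigroupProperties +-commutativeSemigroup using (interchange)

-- Stronger than DegreeAtMost, which only constrains monomials with coefficient 1.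
AllDeg≤ : ℕ → Poly s → Set
AllDeg≤ d = All (λ M → deg M ≤ d)

AllDeg≤-*ₚ : ∀ {d e} (p q : Poly s) → AllDeg≤ d p → AllDeg≤ e q → AllDeg≤ (d + e) (p *ₚ q)
AllDeg≤-*ₚ []      q []         q≤e = []
AllDeg≤-*ₚ (M ∷ p) q (M≤d ∷ p≤d) q≤e =
  ++⁺ (map⁺ (All.map (λ {N} N≤e → ≤-trans (deg-·ₘ M N) (+-mono-≤ M≤d N≤e)) q≤e)) (AllDeg≤-*ₚ p q p≤d q≤e)

AllDeg≤⇒DegreeAtMost : ∀ {d} (p : Poly s) → AllDeg≤ d p → DegreeAtMost d p
AllDeg≤⇒DegreeAtMost (N ∷ p) (N≤d ∷ p≤d) M coeff≡true with N ≟ₘ M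
... | yes refl = N≤d
... | no _     = AllDeg≤⇒DegreeAtMost p p≤d M coeff≡true

-- P Φ S is definitionally ∏⟨ factor Φ ⟩ S.
∏⟨_⟩ : (Fin m → Poly s) → Subset m → Poly s
∏⟨ fac ⟩ S = foldr (λ u acc → if lookup S u then fac u *ₚ acc else acc) oneₚ (allFin _)

∏-∷ : ∀ (fac : Fin (suc m) → Poly s) b S →
      ∏⟨ fac ⟩ (b ∷ S) ≡ (if b then fac zero *ₚ ∏⟨ fac ∘ suc ⟩ S else ∏⟨ fac ∘ suc ⟩ S)
∏-∷ {m} fac b S = cong (λ acc → if b then fac zero *ₚ acc else acc) (begin
  foldr step oneₚ (tabulate suc)            ≡⟨ cong (foldr step oneₚ) (sym (map-tabulate id suc)) ⟩
  foldr step oneₚ (map suc (allFin m))      ≡⟨ foldr-map step suc oneₚ (allFin m) ⟩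
  ∏⟨ fac ∘ suc ⟩ S                          ∎)
  where open ≡-Reasoning
        step = λ u acc → if lookup (b ∷ S) u then fac u *ₚ acc else acc

eval-∏ : ∀ (f : Mono s → Bool) → Multiplicative f → eval f oneₚ ≡ true →
         ∀ (fac : Fin m → Poly s) S → eval f (∏⟨ fac ⟩ S) ≡ ⋀ S (eval f ∘ fac)
eval-∏ f f-mul f-one fac []            = f-one
eval-∏ f f-mul f-one fac (inside ∷ S)  rewrite ∏-∷ fac inside S =
  trans (eval-*ₚ f f-mul (fac zero) _) (cong (_ ∧_) (eval-∏ f f-mul f-one (fac ∘ suc) S))
eval-∏ f f-mul f-one fac (outside ∷ S) rewrite ∏-∷ fac outside S = eval-∏ f f-mul f-one (fac ∘ suc) S

AllDeg≤-∏ : ∀ {d} (fac : Fin m → Poly s) → (∀ u → AllDeg≤ d (fac u)) → ∀ S → AllDeg≤ (d * ∣ S ∣) (∏⟨ fac ⟩ S)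
AllDeg≤-∏ {s = s} {d} fac fac≤d [] = ≤-reflexive deg-1≡d*0 ∷ []
  where deg-1≡d*0 : ∣ ⊥ {s} ∣ + ∣ ⊥ {s} ∣ + ∣ ⊥ {s} ∣ ≡ d * 0
        deg-1≡d*0 rewrite ∣⊥∣≡0 s | *-zeroʳ d = refl
AllDeg≤-∏ {d = d} fac fac≤d (inside ∷ S) rewrite ∏-∷ fac inside S | *-suc d ∣ S ∣ =
  AllDeg≤-*ₚ (fac zero) _ (fac≤d zero) (AllDeg≤-∏ (fac ∘ suc) (fac≤d ∘ suc) S)
AllDeg≤-∏ fac fac≤d (outside ∷ S) rewrite ∏-∷ fac outside S = AllDeg≤-∏ (fac ∘ suc) (fac≤d ∘ suc) S

module _ {m n s} (Φ : ThreeArrayScheme m n s) where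
  open ThreeArrayScheme Φ

  at-σ : (T : Subset m) → ∣ T ∣ ≤ n → Mono s → Bool
  at-σ T h = evalAt (σA T h) (σB T h) (σC T h)

  query : (T : Subset m) → ∣ T ∣ ≤ n → Fin m → Bool
  query T h u = (σA T h (x u) ∧ σB T h (y u)) xor σC T h (z u)

  eval-factor : ∀ T (h : ∣ T ∣ ≤ n) u → eval (at-σ T h) (factor Φ u) ≡ query T h u
  eval-factor T h u
    rewrite ⋀-⁅⁆ (x u) (σA T h) | ⋀-⁅⁆ (y u) (σB T h) | ⋀-⁅⁆ (z u) (σC T h)
          | ⋀-⊥ (σA T h) | ⋀-⊥ (σB T h) | ⋀-⊥ (σC T h)
    = cong₂ _xor_ (cong (σA T h (x u) ∧_) (∧-identityʳ (σB T h (y u)))) (xor-identityʳ (σC T h (z u)))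

  eval-P : ∀ T (h : ∣ T ∣ ≤ n) S → eval (at-σ T h) (P Φ S) ≡ ⋀ S (eval (at-σ T h) ∘ factor Φ)
  eval-P T h = eval-∏ (at-σ T h) (evalAt-multiplicative (σA T h) (σB T h) (σC T h)) (evalAt-oneₚ (σA T h) (σB T h) (σC T h)) (factor Φ)

  P-at-σ-self : ∀ T (h : ∣ T ∣ ≤ n) → eval (at-σ T h) (P Φ T) ≡ true
  P-at-σ-self T h = trans (eval-P T h T)
    (⋀-intro T (λ {u} u∈T → trans (eval-factor T h u) (proj₂ (correct T h u) u∈T)))

  P-at-σ⇒⊆ : ∀ T (h : ∣ T ∣ ≤ n) S → eval (at-σ T h) (P Φ S) ≡ true → S ⊆ T
  P-at-σ⇒⊆ T h S P≡true {u} u∈S =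
    proj₁ (correct T h u) (trans (sym (eval-factor T h u)) (⋀-elim S (trans (sym (eval-P T h S)) P≡true) u∈S))

  P-at-σ⇒≡ : ∀ {S T} (∣S∣≡n : ∣ S ∣ ≡ n) (∣T∣≡n : ∣ T ∣ ≡ n) →
             eval (at-σ T (≤-reflexive ∣T∣≡n)) (P Φ S) ≡ true → S ≡ T
  P-at-σ⇒≡ {S} {T} ∣S∣≡n ∣T∣≡n P≡true =
    p⊆q⇒∣p∣≡∣q∣⇒p≡q (P-at-σ⇒⊆ T (≤-reflexive ∣T∣≡n) S P≡true) (trans ∣S∣≡n (sym ∣T∣≡n))

  P-degree : ∀ S → ∣ S ∣ ≡ n → DegreeAtMost (2 * n) (P Φ S)
  P-degree S refl = AllDeg≤⇒DegreeAtMost (P Φ S) (AllDeg≤-∏ (factor Φ) factor≤2 S)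
    where
    factor≤2 : ∀ u → AllDeg≤ 2 (factor Φ u)
    factor≤2 u =
      ≤-reflexive (cong₂ _+_ (cong₂ _+_ (∣⁅x⁆∣≡1 (x u)) (∣⁅x⁆∣≡1 (y u))) (∣⊥∣≡0 s)) ∷
      ≤-trans (≤-reflexive (cong₂ _+_ (cong₂ _+_ (∣⊥∣≡0 s) (∣⊥∣≡0 s)) (∣⁅x⁆∣≡1 (z u)))) (n≤1+n 1) ∷ []

  -- Evaluate at σ(S) for the first S of L: P_S gives 1 and every other P_T gives 0.
  P-independent : ∀ (L : List (Subset m)) → Unique L → All (λ S → ∣ S ∣ ≡ n) L →
                  IsZero (sumₚ (map (P Φ) L)) → L ≡ []
  P-independent []      _          _             _     = refl
  P-independent (S ∷ L) (S∉L ∷ _) (∣S∣≡n ∷ ∣L∣≡n) sum≈0 =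
    contradiction (trans (sym sum↦1) (eval-zero f (sumₚ (map (P Φ) (S ∷ L))) sum≈0)) λ ()
    where
    f = at-σ S (≤-reflexive ∣S∣≡n)
    others↦0 : All (λ p → eval f p ≡ false) (map (P Φ) L)
    others↦0 = map⁺ (All.zipWith (λ (S≢T , ∣T∣≡n) → ¬-not (S≢T ∘ sym ∘ P-at-σ⇒≡ ∣T∣≡n ∣S∣≡n)) (S∉L , ∣L∣≡n))
    sum↦1 : eval f (P Φ S ++ sumₚ (map (P Φ) L)) ≡ true
    sum↦1 = trans (eval-++ f (P Φ S) _) (cong₂ _xor_ (P-at-σ-self S _) (eval-sumₚ f _ others↦0))

  P-injective : ∀ S T → ∣ S ∣ ≡ n → ∣ T ∣ ≡ n → P Φ S ≈ₚ P Φ T → S ≡ T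
  P-injective S T ∣S∣≡n ∣T∣≡n PS≈PT with ≡-dec _≟ᵇ_ S T
  ... | yes S≡T = S≡T
  ... | no  S≢T = contradiction
    (P-independent (S ∷ T ∷ []) ((S≢T ∷ []) ∷ [] ∷ []) (∣S∣≡n ∷ ∣T∣≡n ∷ []) sum≈0) λ ()
    where
    sum≈0 : IsZero (P Φ S ++ P Φ T ++ [])
    sum≈0 M rewrite coeff-++ (P Φ S) (P Φ T ++ []) M | ++-identityʳ (P Φ T) | PS≈PT M = xor-same (coeff (P Φ T) M)

lemma11 : (m n s : ℕ) → 1 ≤ n → (Φ : ThreeArrayScheme m n s) →
    ((S : Subset m) → ∣ S ∣ ≡ n → DegreeAtMost (2 * n) (P Φ S))
    × ((S T : Subset m) → ∣ S ∣ ≡ n → ∣ T ∣ ≡ n → P Φ S ≈ₚ P Φ T → S ≡ T)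
    × ((L : List (Subset m)) → Unique L → All (λ S → ∣ S ∣ ≡ n) L →
    IsZero (sumₚ (map (P Φ) L)) → L ≡ [])
lemma11 m n s _ Φ = P-degree Φ , P-injective Φ , P-independent Φ
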